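{- Let $\Gamma=\mathrm{Cay}(G,S)$ be connected, let $A$ be a colour-preserving group of automorphisms of $\Gamma$ that is normalised by $G_R$, and let $v$ be a vertex of $\Gamma$. If $A_v$ has a subgroup $U$ such that $U\le(A_v)^2$ and no other subgroup of $A_v$ is isomorphic to $U$, then $U=1$. In particular, $A_v$ is not isomorphic to $\mathbb{Z}_{2^n}$ for any $n\ge2$, nor to $\mathrm{D}_{2^n}$ for any $n\ge3$.
   Context: All groups and graphs are finite. For a group $G$ and inverse-closed $S\subseteq G$, $\mathrm{Cay}(G,S)$ is the edge-coloured graph with vertex set $G$ and edges $\{g,sg\}$ ($g\in G,s\in S$) of colour $\{s,s^{ -1}\}$. A colour-preserving automorphism maps each edge to an edge of the same colour. $G_R$ is the right regular representation of $G$. For a group $X$, $X^2=\langle x^2\mid x\in X\rangle$. $A_v$ is the stabiliser of $v$ in $A$. $\mathrm{D}_m$ denotes the dihedral group of order $2m$. -}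

module Defs where

open import Data.Nat using (ℕ; zero; suc; _+_; _∸_)
open import Data.Nat.DivMod using (_mod_)
open import Data.Fin using (Fin; toℕ)
open import Data.Product using (Σ; _×_; _,_)
open import Data.Sum using (_⊎_)
open import Relation.Binary.PropositionalEquality using (_≡_)

-- Finite groups with carrier Fin n (every finite group is isomorphic
-- to one of these).

record FinGroup (n : ℕ) : Set where
  field
    _·_   : Fin n → Fin n → Fin n
    e     : Fin n
    inv   : Fin n → Fin n
    assoc : ∀ x y z → (x · y) · z ≡ x · (y · z)
    idˡ   : ∀ x → e · x ≡ x
    idʳ   : ∀ x → x · e ≡ x
    invˡ  : ∀ x → inv x · x ≡ e
    invʳ  : ∀ x → x · inv x ≡ e

record Perm (n : ℕ) : Set where
  field
    to    : Fin n → Fin n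
    from  : Fin n → Fin n
    to∘from : ∀ x → to (from x) ≡ x
    from∘to : ∀ x → from (to x) ≡ x
open Perm public

_≈ₚ_ : ∀ {n} → Perm n → Perm n → Set
p ≈ₚ q = ∀ x → to p x ≡ to q x

idP : ∀ {n} → Perm n
idP = record { to = λ x → x ; from = λ x → x
             ; to∘from = λ _ → Relation.Binary.PropositionalEquality.refl
             ; from∘to = λ _ → Relation.Binary.PropositionalEquality.refl }

_∘ₚ_ : ∀ {n} → Perm n → Perm n → Perm n
p ∘ₚ q = record
  { to = λ x → to p (to q x)
  ; from = λ x → from q (from p x)
  ; to∘from = λ x → Relation.Binary.PropositionalEquality.trans
      (Relation.Binary.PropositionalEquality.cong (to p) (to∘from q (from p x))) (to∘from p x)
  ; from∘to = λ x → Relation.Binary.PropositionalEquality.trans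
      (Relation.Binary.PropositionalEquality.cong (from q) (from∘to p (to q x))) (from∘to q x) }

_⁻¹ₚ : ∀ {n} → Perm n → Perm n
p ⁻¹ₚ = record { to = from p ; from = to p ; to∘from = from∘to p ; from∘to = to∘from p }

_⊆_ : ∀ {n} → (Perm n → Set) → (Perm n → Set) → Set
H ⊆ K = ∀ p → H p → K p

record IsSubgroup {n} (H : Perm n → Set) : Set where
  field
    resp  : ∀ p q → p ≈ₚ q → H p → H q
    id∈   : H idP
    ∘∈    : ∀ p q → H p → H q → H (p ∘ₚ q)
    ⁻¹∈   : ∀ p → H p → H (p ⁻¹ₚ)

data Squares {n} (X : Perm n → Set) : Perm n → Set where
  sq   : ∀ p → X p → Squares X (p ∘ₚ p)
  one  : Squares X idP
  comp : ∀ p q → Squares X p → Squares X q → Squares X (p ∘ₚ q)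
  sinv : ∀ p → Squares X p → Squares X (p ⁻¹ₚ)
  sresp : ∀ p q → p ≈ₚ q → Squares X p → Squares X q

record Iso {n} (W U : Perm n → Set) : Set where
  field
    f     : ∀ p → W p → Perm n
    into  : ∀ p (w : W p) → U (f p w)
    wd    : ∀ p q (wp : W p) (wq : W q) → p ≈ₚ q → f p wp ≈ₚ f q wq
    inj   : ∀ p q (wp : W p) (wq : W q) → f p wp ≈ₚ f q wq → p ≈ₚ q
    surj  : ∀ q → U q → Σ (Perm _) λ p → Σ (W p) λ wp → f p wp ≈ₚ q
    hom   : ∀ p q r (wp : W p) (wq : W q) (wr : W r) →
            r ≈ₚ (p ∘ₚ q) → f r wr ≈ₚ (f p wp ∘ₚ f q wq)

record IsoTo {n} (H : Perm n → Set) (C : Set) (_·_ : C → C → C) : Set where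
  field
    f    : C → Perm n
    into : ∀ c → H (f c)
    inj  : ∀ c d → f c ≈ₚ f d → c ≡ d
    surj : ∀ p → H p → Σ C λ c → f c ≈ₚ p
    hom  : ∀ c d → f (c · d) ≈ₚ (f c ∘ₚ f d)

CycOp : ∀ {m} → Fin m → Fin m → Fin m
CycOp {suc k} a b = (toℕ a + toℕ b) mod suc k

negMod : ∀ {m} → Fin m → Fin m
negMod {suc k} a = (suc k ∸ toℕ a) mod suc k

xor : Fin 2 → Fin 2 → Fin 2
xor a b = CycOp a b

-- (a , i) represents r^i s^a ; (r^i s^a)(r^j s^b) = r^(i ± j) s^(a+b)
DihOp : ∀ {m} → (Fin 2 × Fin m) → (Fin 2 × Fin m) → (Fin 2 × Fin m)
DihOp (Data.Fin.zero , i) (b , j) = (b , CycOp i j)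
DihOp (Data.Fin.suc _ , i) (b , j) = (xor (Data.Fin.suc Data.Fin.zero) b , CycOp i (negMod j))

module _ {n} (G : FinGroup n) where
  open FinGroup G

  InvClosed : (Fin n → Set) → Set
  InvClosed S = ∀ s → S s → S (inv s)

  -- vertices reachable from e in Cay(G,S) (edges {g, s g})
  data Reach (S : Fin n → Set) : Fin n → Set where
    base : Reach S e
    step : ∀ s g → S s → Reach S g → Reach S (s · g)

  Connected : (Fin n → Set) → Set
  Connected S = ∀ g → Reach S g

  -- φ maps each edge {g, s g} (colour {s,s⁻¹}) to an edge of colour {s,s⁻¹}
  ColourPreserving : (Fin n → Set) → Perm n → Set
  ColourPreserving S φ = ∀ s g → S s →
    (to φ (s · g) ≡ s · to φ g) ⊎ (to φ (s · g) ≡ inv s · to φ g)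

  rightMul : Fin n → Perm n
  rightMul g = record
    { to = λ x → x · g ; from = λ x → x · inv g
    ; to∘from = λ x → Relation.Binary.PropositionalEquality.trans (assoc x (inv g) g)
        (Relation.Binary.PropositionalEquality.trans
          (Relation.Binary.PropositionalEquality.cong (x ·_) (invˡ g)) (idʳ x))
    ; from∘to = λ x → Relation.Binary.PropositionalEquality.trans (assoc x g (inv g))
        (Relation.Binary.PropositionalEquality.trans
          (Relation.Binary.PropositionalEquality.cong (x ·_) (invʳ g)) (idʳ x)) }

  NormalisedByGR : (Perm n → Set) → Set
  NormalisedByGR A = ∀ g a → A a → A ((rightMul g ⁻¹ₚ) ∘ₚ (a ∘ₚ rightMul g))

Stab : ∀ {n} → (Perm n → Set) → Fin n → Perm n → Set
Stab A v p = A p × (to p v ≡ v)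

-- A colour-preserving a ∈ A_v sends s v to s v or s⁻¹ v, so a² fixes every neighbour of v;
-- hence all of (A_v)² does. If U ≤ (A_v)² is the only subgroup of A_v of its isomorphism type
-- and U fixes a vertex w = v h, then conjugating U by right multiplication with h (allowed as
-- G_R normalises A) gives an isomorphic subgroup of A_v, which therefore lies in U ≤ (A_v)²
-- and fixes the neighbours of v; translating back, U fixes the neighbours of w. By
-- connectivity U fixes everything, so U = 1. In Z_{2^k} (k ≥ 2) the subgroup of order 2, and in
-- D_{2^k} (k ≥ 3) the cyclic subgroup of order 4 of the rotations, is generated by a square
-- and is unique of its isomorphism type (all non-rotations of D_{2^k} are involutions), so
-- neither group can be A_v.

module Submission where

open import Defs
open import Data.Empty using (⊥; ⊥-elim)
open import Data.Fin using (Fin; toℕ) renaming (zero to fzero; suc to fsuc)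
open import Data.Fin.Properties using (toℕ-injective; toℕ-fromℕ<; toℕ<n)
open import Data.Nat
  using (ℕ; zero; suc; _+_; _*_; _∸_; _^_; _%_; _≤_; _<_; z≤n; s≤s; NonZero; >-nonZero)
open import Data.Nat.DivMod using (_mod_; m%n<n; %-distribˡ-+; m*n%n≡0; n%n≡0; m%n%n≡m%n; m<n⇒m%n≡m)
open import Data.Nat.Divisibility using (_∣_; divides; ∣-refl; ∣⇒≤; m%n≡0⇒n∣m; *-cancelˡ-∣)
open import Data.Nat.Properties
  using ( ≤-refl; <⇒≤; <⇒≱; +-mono-<; +-mono-<-≤; m+[n∸m]≡n; m^n>0; +-identityʳ; *-monoˡ-<
        ; *-assoc; *-identityˡ; *-distribʳ-+; m*n≢0⇒m≢0)
open import Data.Nat.Tactic.RingSolver using (solve-∀)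
open import Data.Product using (Σ; ∃-syntax; _×_; _,_; proj₁; proj₂)
open import Data.Sum using (_⊎_; inj₁; inj₂)
open import Relation.Nullary using (¬_)
open import Relation.Binary.PropositionalEquality

module _ {n : ℕ} where

  ∘ₚ-cong : {p p′ q q′ : Perm n} → p ≈ₚ p′ → q ≈ₚ q′ → (p ∘ₚ q) ≈ₚ (p′ ∘ₚ q′)
  ∘ₚ-cong {p = p} p≈p′ q≈q′ x = trans (cong (to p) (q≈q′ x)) (p≈p′ _)

  ⁻¹ₚ-cong : {p q : Perm n} → p ≈ₚ q → (p ⁻¹ₚ) ≈ₚ (q ⁻¹ₚ)
  ⁻¹ₚ-cong {p} {q} p≈q x =
    trans (cong (from p) (sym (trans (p≈q (from q x)) (to∘from q x)))) (from∘to p (from q x))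

  to-injective : (p : Perm n) {x y : Fin n} → to p x ≡ to p y → x ≡ y
  to-injective p {x} {y} e = trans (sym (from∘to p x)) (trans (cong (from p) e) (from∘to p y))

  idempotent⇒≈idP : (p : Perm n) → (p ∘ₚ p) ≈ₚ p → p ≈ₚ idP
  idempotent⇒≈idP p pp≈p x = to-injective p (pp≈p x)

  ⁻¹ₚ-unique : (p q : Perm n) → (p ∘ₚ q) ≈ₚ idP → (p ⁻¹ₚ) ≈ₚ q
  ⁻¹ₚ-unique p q pq≈id x = trans (cong (from p) (sym (pq≈id x))) (from∘to p (to q x))

  pow : Perm n → ℕ → Perm n
  pow t zero    = idP
  pow t (suc m) = t ∘ₚ pow t m

  pow-cong : {p q : Perm n} → p ≈ₚ q → ∀ m → pow p m ≈ₚ pow q m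
  pow-cong         p≈q zero    x = refl
  pow-cong {p} {q} p≈q (suc m)   = ∘ₚ-cong {p = p} {q} {pow p m} {pow q m} p≈q (pow-cong p≈q m)

  pow∈ : {H : Perm n → Set} → IsSubgroup H → ∀ t → H t → ∀ m → H (pow t m)
  pow∈ H-sub t t∈H zero    = IsSubgroup.id∈ H-sub
  pow∈ H-sub t t∈H (suc m) = IsSubgroup.∘∈ H-sub t (pow t m) t∈H (pow∈ H-sub t t∈H m)

module _ {n : ℕ} {W U : Perm n → Set} (W-sub : IsSubgroup W) (iso : Iso W U) where
  open Iso iso

  iso-idP : f idP (IsSubgroup.id∈ W-sub) ≈ₚ idP
  iso-idP = idempotent⇒≈idP (f idP w₀) (λ x → sym (hom idP idP idP w₀ w₀ w₀ (λ _ → refl) x))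
    where w₀ = IsSubgroup.id∈ W-sub

  iso-pow : ∀ t (t∈W : W t) m → f (pow t m) (pow∈ W-sub t t∈W m) ≈ₚ pow (f t t∈W) m
  iso-pow t t∈W zero      = iso-idP
  iso-pow t t∈W (suc m) x =
    trans (hom t (pow t m) _ t∈W (pow∈ W-sub t t∈W m) _ (λ _ → refl) x)
          (cong (to (f t t∈W)) (iso-pow t t∈W m x))

  ≈pow-of-iso-≈pow : ∀ t (t∈W : W t) p (p∈W : W p) m →
                     f p p∈W ≈ₚ pow (f t t∈W) m → p ≈ₚ pow t m
  ≈pow-of-iso-≈pow t t∈W p p∈W m fp≈ =
    inj p (pow t m) p∈W (pow∈ W-sub t t∈W m) (λ x → trans (fp≈ x) (sym (iso-pow t t∈W m x)))

module _ {n : ℕ} (G : FinGroup n) where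
  open FinGroup G

  inv-involutive : ∀ x → inv (inv x) ≡ x
  inv-involutive x = begin
    inv (inv x)                ≡⟨ sym (idʳ _) ⟩
    inv (inv x) · e            ≡⟨ cong (inv (inv x) ·_) (sym (invˡ x)) ⟩
    inv (inv x) · (inv x · x)  ≡⟨ sym (assoc _ _ _) ⟩
    (inv (inv x) · inv x) · x  ≡⟨ cong (_· x) (invˡ (inv x)) ⟩
    e · x                      ≡⟨ idˡ x ⟩
    x                          ∎
    where open ≡-Reasoning

  FixesNeighbours : (Fin n → Set) → Fin n → Perm n → Set
  FixesNeighbours S w p = ∀ s → S s → to p (s · w) ≡ s · w

  fixed-point-neighbour : ∀ {S a w} → ColourPreserving G S a → to a w ≡ w → ∀ s → S s →
                          (to a (s · w) ≡ s · w) ⊎ (to a (s · w) ≡ inv s · w)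
  fixed-point-neighbour {w = w} a-cp aw≡w s s∈S with a-cp s w s∈S
  ... | inj₁ e = inj₁ (trans e (cong (s ·_) aw≡w))
  ... | inj₂ e = inj₂ (trans e (cong (inv s ·_) aw≡w))

  square-fixesNeighbours : ∀ {S} → InvClosed G S → ∀ {a w} →
                           ColourPreserving G S a → to a w ≡ w → FixesNeighbours S w (a ∘ₚ a)
  square-fixesNeighbours {S} S-inv {a} {w} a-cp aw≡w s s∈S
    with fixed-point-neighbour {S} {a} a-cp aw≡w s s∈S
  ... | inj₁ a-fixes = trans (cong (to a) a-fixes) a-fixes
  ... | inj₂ a-flips with fixed-point-neighbour {S} {a} a-cp aw≡w (inv s) (S-inv s s∈S)
  ...   | inj₁ a-fixes′ = trans (cong (to a) a-flips)
                            (trans a-fixes′ (sym (to-injective a (trans a-flips (sym a-fixes′)))))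
  ...   | inj₂ a-flips′ = trans (cong (to a) a-flips)
                            (trans a-flips′ (cong (_· w) (inv-involutive s)))

  squares-fixNeighbours : ∀ {S} → InvClosed G S → ∀ {X w} →
                          (∀ a → X a → ColourPreserving G S a × to a w ≡ w) →
                          Squares X ⊆ FixesNeighbours S w
  squares-fixNeighbours {S} S-inv {w = w} X-fix _ (sq a a∈X) =
    square-fixesNeighbours {S} S-inv {a} {w} (proj₁ (X-fix a a∈X)) (proj₂ (X-fix a a∈X))
  squares-fixNeighbours S-inv X-fix _ one s s∈S = refl
  squares-fixNeighbours S-inv X-fix _ (comp p q p∈ q∈) s s∈S =
    trans (cong (to p) (squares-fixNeighbours S-inv X-fix q q∈ s s∈S))
          (squares-fixNeighbours S-inv X-fix p p∈ s s∈S)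
  squares-fixNeighbours S-inv X-fix _ (sinv p p∈) s s∈S =
    trans (cong (from p) (sym (squares-fixNeighbours S-inv X-fix p p∈ s s∈S))) (from∘to p _)
  squares-fixNeighbours S-inv X-fix _ (sresp p q p≈q p∈) s s∈S =
    trans (sym (p≈q _)) (squares-fixNeighbours S-inv X-fix p p∈ s s∈S)

  conj : Fin n → Perm n → Perm n
  conj h q = (rightMul G h ⁻¹ₚ) ∘ₚ (q ∘ₚ rightMul G h)

  conj-fixes⇒fixes : ∀ h q x → to (conj h q) x ≡ x → to q (x · h) ≡ x · h
  conj-fixes⇒fixes h q x fixes = trans (sym (to∘from (rightMul G h) _)) (cong (_· h) fixes)

  fixes⇒conj-fixes : ∀ h q x → to q (x · h) ≡ x · h → to (conj h q) x ≡ x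
  fixes⇒conj-fixes h q x fixes = trans (cong (_· inv h) fixes) (from∘to (rightMul G h) x)

  conj-cong : ∀ h {q q′} → q ≈ₚ q′ → conj h q ≈ₚ conj h q′
  conj-cong h q≈q′ x = cong (_· inv h) (q≈q′ (x · h))

  conj-injective : ∀ h q q′ → conj h q ≈ₚ conj h q′ → q ≈ₚ q′
  conj-injective h q q′ conj≈ y =
    subst (λ z → to q z ≡ to q′ z) (to∘from (rightMul G h) y)
          (to-injective (rightMul G h ⁻¹ₚ) (conj≈ (y · inv h)))

  conj-∘ₚ : ∀ h q q′ → (conj h q ∘ₚ conj h q′) ≈ₚ conj h (q ∘ₚ q′)
  conj-∘ₚ h q q′ x = cong (λ z → to q z · inv h) (to∘from (rightMul G h) (to q′ (x · h)))

  Conjugates : Fin n → (Perm n → Set) → Perm n → Set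
  Conjugates h U p = ∃[ q ] U q × p ≈ₚ conj h q

  module _ (h : Fin n) {U : Perm n → Set} (U-sub : IsSubgroup U) where

    conjugates-isSubgroup : IsSubgroup (Conjugates h U)
    conjugates-isSubgroup = record
      { resp = λ { p p′ p≈p′ (q , q∈U , p≈) → q , q∈U , λ x → trans (sym (p≈p′ x)) (p≈ x) }
      ; id∈  = idP , IsSubgroup.id∈ U-sub , λ x → sym (from∘to (rightMul G h) x)
      ; ∘∈   = λ { p p′ (q , q∈U , p≈) (q′ , q′∈U , p′≈) →
                   q ∘ₚ q′ , IsSubgroup.∘∈ U-sub q q′ q∈U q′∈U ,
                   λ x → trans (∘ₚ-cong {p = p} {conj h q} {p′} {conj h q′} p≈ p′≈ x)
                               (conj-∘ₚ h q q′ x) }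
      ; ⁻¹∈  = λ { p (q , q∈U , p≈) →
                   q ⁻¹ₚ , IsSubgroup.⁻¹∈ U-sub q q∈U , ⁻¹ₚ-cong {p = p} {conj h q} p≈ }
      }

    conjugates-iso : Iso (Conjugates h U) U
    conjugates-iso = record
      { f     = λ p c → proj₁ c
      ; into  = λ p c → proj₁ (proj₂ c)
      ; wd    = λ { p p′ (q , _ , p≈) (q′ , _ , p′≈) p≈p′ →
                    conj-injective h q q′ λ x → trans (sym (p≈ x)) (trans (p≈p′ x) (p′≈ x)) }
      ; inj   = λ { p p′ (q , _ , p≈) (q′ , _ , p′≈) q≈q′ x →
                    trans (p≈ x) (trans (conj-cong h {q} {q′} q≈q′ x) (sym (p′≈ x))) }
      ; surj  = λ q q∈U → conj h q , (q , q∈U , λ _ → refl) , λ _ → refl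
      ; hom   = λ { p p′ r (q , _ , p≈) (q′ , _ , p′≈) (q″ , _ , r≈) r≈pp′ →
                    conj-injective h q″ (q ∘ₚ q′) λ x →
                      trans (sym (r≈ x)) (trans (r≈pp′ x)
                        (trans (∘ₚ-cong {p = p} {conj h q} {p′} {conj h q′} p≈ p′≈ x)
                               (conj-∘ₚ h q q′ x))) }
      }

module _ {K : ℕ} where

  toℕ-mod : ∀ a → toℕ (a mod suc K) ≡ a % suc K
  toℕ-mod a = toℕ-fromℕ< (m%n<n a (suc K))

  mod-cong : ∀ a b → a % suc K ≡ b % suc K → a mod suc K ≡ b mod suc K
  mod-cong a b a≡b = toℕ-injective (trans (toℕ-mod a) (trans a≡b (sym (toℕ-mod b))))

  mod-toℕ : ∀ (j : Fin (suc K)) → toℕ j mod suc K ≡ j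
  mod-toℕ j = toℕ-injective (trans (toℕ-mod (toℕ j)) (m<n⇒m%n≡m (toℕ<n j)))

  CycOp-mod : ∀ a b → CycOp (a mod suc K) (b mod suc K) ≡ (a + b) mod suc K
  CycOp-mod a b = mod-cong (toℕ (a mod N) + toℕ (b mod N)) (a + b) (begin
    (toℕ (a mod N) + toℕ (b mod N)) % N ≡⟨ cong₂ (λ x y → (x + y) % N) (toℕ-mod a) (toℕ-mod b) ⟩
    (a % N + b % N) % N                  ≡⟨ sym (%-distribˡ-+ a b N) ⟩
    (a + b) % N                          ∎)
    where
    open ≡-Reasoning
    N : ℕ
    N = suc K

CycOp-negMod : ∀ {N} (j : Fin N) → toℕ (CycOp j (negMod j)) ≡ 0
CycOp-negMod {suc K} j = begin
  toℕ (CycOp j (negMod j))                ≡⟨ toℕ-mod (a + toℕ (negMod j)) ⟩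
  (a + toℕ (negMod j)) % N                ≡⟨ cong (λ z → (a + z) % N) (toℕ-mod (N ∸ a)) ⟩
  (a + (N ∸ a) % N) % N                   ≡⟨ %-distribˡ-+ a ((N ∸ a) % N) N ⟩
  (a % N + (N ∸ a) % N % N) % N           ≡⟨ cong (λ z → (a % N + z) % N) (m%n%n≡m%n (N ∸ a) N) ⟩
  (a % N + (N ∸ a) % N) % N               ≡⟨ sym (%-distribˡ-+ a (N ∸ a) N) ⟩
  (a + (N ∸ a)) % N                       ≡⟨ cong (_% N) (m+[n∸m]≡n (<⇒≤ (toℕ<n j))) ⟩
  N % N                                   ≡⟨ n%n≡0 N ⟩
  0                                       ∎
  where
  open ≡-Reasoning
  N a : ℕ
  N = suc K
  a = toℕ j

CycOp-idem-zero : ∀ {N} (c : Fin N) → toℕ c ≡ 0 → CycOp c c ≡ c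
CycOp-idem-zero {suc K} c c≡0 =
  toℕ-injective (trans (toℕ-mod (toℕ c + toℕ c)) (trans (cong (λ z → (z + z) % suc K) c≡0) (sym c≡0)))

module CyclicImage {n K : ℕ} (ρ : Fin (suc K) → Perm n)
                   (ρ-injective : ∀ i j → ρ i ≈ₚ ρ j → i ≡ j)
                   (ρ-hom : ∀ i j → ρ (CycOp i j) ≈ₚ (ρ i ∘ₚ ρ j)) where

  N : ℕ
  N = suc K

  ρℕ : ℕ → Perm n
  ρℕ a = ρ (a mod N)

  ρℕ-cong : ∀ a b → a % N ≡ b % N → ρℕ a ≈ₚ ρℕ b
  ρℕ-cong a b a≡b x = cong (λ j → to (ρ j) x) (mod-cong a b a≡b)

  ρ≈ρℕ-toℕ : ∀ j → ρ j ≈ₚ ρℕ (toℕ j)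
  ρ≈ρℕ-toℕ j x = cong (λ i → to (ρ i) x) (sym (mod-toℕ j))

  ρℕ-+ : ∀ a b → (ρℕ a ∘ₚ ρℕ b) ≈ₚ ρℕ (a + b)
  ρℕ-+ a b x = trans (sym (ρ-hom (a mod N) (b mod N) x)) (cong (λ j → to (ρ j) x) (CycOp-mod a b))

  ρℕ-0 : ρℕ 0 ≈ₚ idP
  ρℕ-0 = idempotent⇒≈idP (ρℕ 0) (ρℕ-+ 0 0)

  ∣⇒ρℕ≈idP : ∀ a → N ∣ a → ρℕ a ≈ₚ idP
  ∣⇒ρℕ≈idP a (divides k a≡kN) x =
    trans (ρℕ-cong a 0 (trans (cong (_% N) a≡kN) (m*n%n≡0 k N)) x) (ρℕ-0 x)

  ρℕ-pow : ∀ a m → pow (ρℕ a) m ≈ₚ ρℕ (m * a)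
  ρℕ-pow a zero    x = sym (ρℕ-0 x)
  ρℕ-pow a (suc m) x = trans (cong (to (ρℕ a)) (ρℕ-pow a m x)) (ρℕ-+ a (m * a) x)

  ρℕ≈idP⇒∣ : ∀ a → ρℕ a ≈ₚ idP → N ∣ a
  ρℕ≈idP⇒∣ a ρa≈id = m%n≡0⇒n∣m a N (trans (sym (toℕ-mod a))
    (cong toℕ (ρ-injective (a mod N) (0 mod N) λ x → trans (ρa≈id x) (sym (ρℕ-0 x)))))

  ρℕ-nontrivial : ∀ a → 0 < a → a < N → ¬ (ρℕ a ≈ₚ idP)
  ρℕ-nontrivial a 0<a a<N ρa≈id = <⇒≱ a<N (∣⇒≤ {{>-nonZero 0<a}} (ρℕ≈idP⇒∣ a ρa≈id))

  Multiples : ℕ → Perm n → Set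
  Multiples q p = ∃[ m ] p ≈ₚ ρℕ (m * q)

  multiples-isSubgroup : ∀ q → IsSubgroup (Multiples q)
  multiples-isSubgroup q = record
    { resp = λ { p p′ p≈p′ (m , p≈) → m , λ x → trans (sym (p≈p′ x)) (p≈ x) }
    ; id∈  = 0 , λ x → sym (ρℕ-0 x)
    ; ∘∈   = λ { p p′ (m , p≈) (m′ , p′≈) → m + m′ , λ x →
               trans (∘ₚ-cong {p = p} {ρℕ (m * q)} {p′} {ρℕ (m′ * q)} p≈ p′≈ x)
                 (trans (ρℕ-+ (m * q) (m′ * q) x)
                        (cong (λ a → to (ρℕ a) x) (sym (*-distribʳ-+ q m m′)))) }
    ; ⁻¹∈  = λ { p (m , p≈) → m * K , ⁻¹ₚ-unique p (ρℕ (m * K * q)) λ x →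
               trans (p≈ _) (trans (ρℕ-+ (m * q) (m * K * q) x)
                 (∣⇒ρℕ≈idP _ (divides (m * q) (inverse-index m q K)) x)) }
    }
    where
    inverse-index : ∀ m q k → m * q + m * k * q ≡ m * q * suc k
    inverse-index = solve-∀

  multiples-generator : ∀ q → Multiples q (ρℕ q)
  multiples-generator q = 1 , λ x → cong (λ a → to (ρℕ a) x) (sym (*-identityˡ q))

  module _ {X : Perm n → Set} (X-resp : ∀ p q → p ≈ₚ q → X p → X q) (ρ∈X : ∀ j → X (ρ j)) where

    multiples⊆ : ∀ q → Multiples q ⊆ X
    multiples⊆ q p (m , p≈) = X-resp _ p (λ x → sym (p≈ x)) (ρ∈X _)

    multiples-of-even⊆squares : ∀ h → Multiples (2 * h) ⊆ Squares X
    multiples-of-even⊆squares h p (m , p≈) =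
      sresp (ρℕ (m * h) ∘ₚ ρℕ (m * h)) p
        (λ x → trans (ρℕ-+ (m * h) (m * h) x)
                 (trans (cong (λ a → to (ρℕ a) x) (double m h)) (sym (p≈ x))))
        (sq _ (ρ∈X _))
      where
      double : ∀ m h → m * h + m * h ≡ m * (2 * h)
      double = solve-∀

  module _ {X : Perm n → Set} (M q : ℕ) (N≡M*q : N ≡ M * q) (0<q : 0 < q)
           (classify : ∀ t → X t → (∃[ j ] t ≈ₚ ρ j) ⊎ (2 < M × (t ∘ₚ t) ≈ₚ idP))
           {W : Perm n → Set} (W-sub : IsSubgroup W) (W⊆X : W ⊆ X) (iso : Iso W (Multiples q)) where
    open Iso iso

    private
      generator-preimage : Σ (Perm n) λ p → Σ (W p) λ p∈W → f p p∈W ≈ₚ ρℕ q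
      generator-preimage = surj (ρℕ q) (multiples-generator q)
      t : Perm n
      t = proj₁ generator-preimage
      t∈W : W t
      t∈W = proj₁ (proj₂ generator-preimage)
      ft≈ρq : f t t∈W ≈ₚ ρℕ q
      ft≈ρq = proj₂ (proj₂ generator-preimage)

    iso-pow-generator : ∀ m → f (pow t m) (pow∈ W-sub t t∈W m) ≈ₚ ρℕ (m * q)
    iso-pow-generator m x = trans (iso-pow W-sub iso t t∈W m x)
      (trans (pow-cong {p = f t t∈W} {ρℕ q} ft≈ρq m x) (ρℕ-pow q m x))

    -- t has order dividing M, so a rotation t = ρ j has N = M q dividing M j, i.e. q ∣ j.
    rotation-generator∈multiples : ∀ j → t ≈ₚ ρ j → Multiples q t
    rotation-generator∈multiples j t≈ρj = d , λ x →
      trans (t≈ρj x) (trans (ρ≈ρℕ-toℕ j x) (cong (λ a → to (ρℕ a) x) j≡d*q))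
      where
      t^M≈idP : pow t M ≈ₚ idP
      t^M≈idP = ≈pow-of-iso-≈pow W-sub iso t t∈W (pow t M) (pow∈ W-sub t t∈W M) 0 λ x →
        trans (iso-pow-generator M x) (∣⇒ρℕ≈idP (M * q) (subst (N ∣_) N≡M*q ∣-refl) x)
      ρ[Mj]≈idP : ρℕ (M * toℕ j) ≈ₚ idP
      ρ[Mj]≈idP x = trans (sym (ρℕ-pow (toℕ j) M x))
        (trans (sym (pow-cong {p = t} {ρℕ (toℕ j)} (λ y → trans (t≈ρj y) (ρ≈ρℕ-toℕ j y)) M x))
          (t^M≈idP x))
      q∣j : q ∣ toℕ j
      q∣j = *-cancelˡ-∣ M {{m*n≢0⇒m≢0 M {{subst NonZero N≡M*q _}}}}
              (subst (_∣ M * toℕ j) N≡M*q (ρℕ≈idP⇒∣ (M * toℕ j) ρ[Mj]≈idP))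
      d : ℕ
      d = _∣_.quotient q∣j
      j≡d*q : toℕ j ≡ d * q
      j≡d*q = _∣_.equality q∣j

    -- An involution t would give ρ (2q) = 1, impossible as 0 < 2q < Mq.
    generator-not-involution : 2 < M → ¬ ((t ∘ₚ t) ≈ₚ idP)
    generator-not-involution 2<M t²≈idP = ρℕ-nontrivial (q + q) (+-mono-< 0<q 0<q) q+q<N λ x →
      trans (sym (ρℕ-+ q q x))
        (trans (sym (∘ₚ-cong {p = f t t∈W} {ρℕ q} {f t t∈W} {ρℕ q} ft≈ρq ft≈ρq x))
        (trans (sym (hom t t (t ∘ₚ t) t∈W t∈W t²∈W (λ _ → refl) x))
          (trans (wd (t ∘ₚ t) idP t²∈W (IsSubgroup.id∈ W-sub) t²≈idP x) (iso-idP W-sub iso x))))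
      where
      t²∈W : W (t ∘ₚ t)
      t²∈W = IsSubgroup.∘∈ W-sub t t t∈W t∈W
      q+q<N : q + q < N
      q+q<N = subst₂ _<_ (cong (q +_) (+-identityʳ q)) (sym N≡M*q)
                (*-monoˡ-< q {{>-nonZero 0<q}} 2<M)

    generator∈multiples : Multiples q t
    generator∈multiples with classify t (W⊆X t t∈W)
    ... | inj₁ (j , t≈ρj)      = rotation-generator∈multiples j t≈ρj
    ... | inj₂ (2<M , t²≈idP) = ⊥-elim (generator-not-involution 2<M t²≈idP)

    iso-image⊆multiples : W ⊆ Multiples q
    iso-image⊆multiples p p∈W =
      IsSubgroup.resp (multiples-isSubgroup q) (pow t m) p (λ x → sym (p≈tᵐ x))
        (pow∈ (multiples-isSubgroup q) t generator∈multiples m)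
      where
      m : ℕ
      m = proj₁ (into p p∈W)
      p≈tᵐ : p ≈ₚ pow t m
      p≈tᵐ = ≈pow-of-iso-≈pow W-sub iso t t∈W p p∈W m λ x →
        trans (proj₂ (into p p∈W) x)
          (trans (sym (ρℕ-pow q m x)) (sym (pow-cong {p = f t t∈W} {ρℕ q} ft≈ρq m x)))

UniqueUpToIso : ∀ {n} → (X U : Perm n → Set) → Set₁
UniqueUpToIso X U = ∀ W → IsSubgroup W → W ⊆ X → Iso W U → W ⊆ U

module _ {n : ℕ} (G : FinGroup n) {S : Fin n → Set} (S-inv : InvClosed G S)
         {A : Perm n → Set} (A-sub : IsSubgroup A)
         (A-cp : ∀ a → A a → ColourPreserving G S a)
         (A-norm : NormalisedByGR G A) (v : Fin n) where
  open FinGroup G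

  stab-resp : ∀ p q → p ≈ₚ q → Stab A v p → Stab A v q
  stab-resp p q p≈q (p∈A , pv≡v) = IsSubgroup.resp A-sub p q p≈q p∈A , trans (sym (p≈q v)) pv≡v

  stab-squares-fixNeighbours : Squares (Stab A v) ⊆ FixesNeighbours G S v
  stab-squares-fixNeighbours =
    squares-fixNeighbours G {S} S-inv {Stab A v} {v} λ a (a∈A , av≡v) → A-cp a a∈A , av≡v

  conjugates⊆stab : ∀ h {U} → U ⊆ A → (∀ u → U u → to u (v · h) ≡ v · h) →
                    Conjugates G h U ⊆ Stab A v
  conjugates⊆stab h U⊆A U-fixes p (q , q∈U , p≈) =
    IsSubgroup.resp A-sub (conj G h q) p (λ x → sym (p≈ x)) (A-norm h q (U⊆A q q∈U)) ,
    trans (p≈ v) (fixes⇒conj-fixes G h q v (U-fixes q q∈U))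

  module _ {U : Perm n → Set} (U-sub : IsSubgroup U) (U⊆stab : U ⊆ Stab A v)
           (U⊆squares : U ⊆ Squares (Stab A v)) (U-unique : UniqueUpToIso (Stab A v) U) where

    Fixed : Fin n → Set
    Fixed w = ∀ u → U u → to u w ≡ w

    fixed-neighbour : ∀ w → Fixed w → ∀ s → S s → Fixed (s · w)
    fixed-neighbour w w-fixed s s∈S u u∈U =
      subst (λ z → to u z ≡ z) sv·h≡s·w (conj-fixes⇒fixes G h u (s · v) conj-u-fixes)
      where
      h = inv v · w
      v·h≡w : v · h ≡ w
      v·h≡w = trans (sym (assoc v (inv v) w)) (trans (cong (_· w) (invʳ v)) (idˡ w))
      sv·h≡s·w : (s · v) · h ≡ s · w
      sv·h≡s·w = trans (assoc s v h) (cong (s ·_) v·h≡w)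
      conj-u∈U : U (conj G h u)
      conj-u∈U = U-unique (Conjugates G h U) (conjugates-isSubgroup G h U-sub)
        (conjugates⊆stab h (λ q q∈U → proj₁ (U⊆stab q q∈U))
          (λ q q∈U → subst (λ z → to q z ≡ z) (sym v·h≡w) (w-fixed q q∈U)))
        (conjugates-iso G h U-sub) (conj G h u) (u , u∈U , λ _ → refl)
      conj-u-fixes : to (conj G h u) (s · v) ≡ s · v
      conj-u-fixes = stab-squares-fixNeighbours _ (U⊆squares _ conj-u∈U) s s∈S

    reachable-fixed : ∀ g → Reach G S g → Fixed (g · v)
    reachable-fixed _ base = subst Fixed (sym (idˡ v)) λ u u∈U → proj₂ (U⊆stab u u∈U)
    reachable-fixed _ (step s g s∈S g-reach) =
      subst Fixed (sym (assoc s g v)) (fixed-neighbour (g · v) (reachable-fixed g g-reach) s s∈S)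

    unique-square-subgroup-trivial : Connected G S → ∀ u → U u → u ≈ₚ idP
    unique-square-subgroup-trivial connected u u∈U x =
      subst (λ z → to u z ≡ z) x·v⁻¹·v≡x (reachable-fixed _ (connected (x · inv v)) u u∈U)
      where
      x·v⁻¹·v≡x : (x · inv v) · v ≡ x
      x·v⁻¹·v≡x = trans (assoc x (inv v) v) (trans (cong (x ·_) (invˡ v)) (idʳ x))

  no-cyclic-subgroup-with-involutory-complement :
    Connected G S → ∀ {N} (M h : ℕ) → 2 ≤ M → 0 < h → N ≡ M * (2 * h) →
    (ρ : Fin N → Perm n) → (∀ j → Stab A v (ρ j)) → (∀ i j → ρ i ≈ₚ ρ j → i ≡ j) →
    (∀ i j → ρ (CycOp i j) ≈ₚ (ρ i ∘ₚ ρ j)) →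
    (∀ t → Stab A v t → (∃[ j ] t ≈ₚ ρ j) ⊎ (2 < M × (t ∘ₚ t) ≈ₚ idP)) → ⊥
  no-cyclic-subgroup-with-involutory-complement _ {zero} _ _ (s≤s (s≤s _)) (s≤s _) ()
  no-cyclic-subgroup-with-involutory-complement connected {suc K} M h 1<M 0<h N≡M*q
                                                ρ ρ∈stab ρ-injective ρ-hom classify =
    ρℕ-nontrivial q 0<q q<N
      (unique-square-subgroup-trivial
        (multiples-isSubgroup q)
        (multiples⊆ stab-resp ρ∈stab q)
        (multiples-of-even⊆squares stab-resp ρ∈stab h)
        (λ W W-sub W⊆stab iso → iso-image⊆multiples M q N≡M*q 0<q classify W-sub W⊆stab iso)
        connected (ρℕ q) (multiples-generator q))
    where
    open CyclicImage ρ ρ-injective ρ-hom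
    q : ℕ
    q = 2 * h
    0<q : 0 < q
    0<q = +-mono-<-≤ 0<h z≤n
    q<N : q < N
    q<N = subst₂ _<_ (+-identityʳ q) (sym N≡M*q) (*-monoˡ-< q {{>-nonZero 0<q}} 1<M)

  stab≇cyclic : Connected G S → ∀ k → 2 ≤ k → ¬ IsoTo (Stab A v) (Fin (2 ^ k)) CycOp
  stab≇cyclic _ zero          ()
  stab≇cyclic _ (suc zero)    (s≤s ())
  stab≇cyclic connected (suc (suc k)) _ iso =
    no-cyclic-subgroup-with-involutory-complement connected
      2 (2 ^ k) ≤-refl (m^n>0 2 k) refl f into inj hom
      λ t t∈stab → let (c , fc≈t) = surj t t∈stab in inj₁ (c , λ x → sym (fc≈t x))
    where open IsoTo iso

  stab≇dihedral : Connected G S → ∀ k → 3 ≤ k → ¬ IsoTo (Stab A v) (Fin 2 × Fin (2 ^ k)) DihOp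
  stab≇dihedral _ zero                ()
  stab≇dihedral _ (suc zero)          (s≤s ())
  stab≇dihedral _ (suc (suc zero))    (s≤s (s≤s ()))
  stab≇dihedral connected (suc (suc (suc k))) _ iso =
    no-cyclic-subgroup-with-involutory-complement connected
      4 (2 ^ k) (s≤s (s≤s z≤n)) (m^n>0 2 k) (sym (*-assoc 2 2 (2 * 2 ^ k)))
      rotation (λ j → into (fzero , j))
      (λ i j ri≈rj → cong proj₂ (inj (fzero , i) (fzero , j) ri≈rj))
      (λ i j → hom (fzero , i) (fzero , j)) classify
    where
    open IsoTo iso
    rotation : Fin (2 ^ suc (suc (suc k))) → Perm n
    rotation j = f (fzero , j)
    rotation-trivial : ∀ c → toℕ c ≡ 0 → rotation c ≈ₚ idP
    rotation-trivial c c≡0 = idempotent⇒≈idP (rotation c) λ x →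
      trans (sym (hom (fzero , c) (fzero , c) x))
            (cong (λ z → to (rotation z) x) (CycOp-idem-zero c c≡0))
    -- (1 , j) encodes the reflection r^j s, whose square is (0 , j − j).
    classify : ∀ t → Stab A v t → (∃[ j ] t ≈ₚ rotation j) ⊎ (2 < 4 × (t ∘ₚ t) ≈ₚ idP)
    classify t t∈stab with surj t t∈stab
    ... | (fzero , j) , ft≈t = inj₁ (j , λ x → sym (ft≈t x))
    ... | (fsuc fzero , j) , ft≈t = inj₂ (s≤s (s≤s (s≤s z≤n)) , λ x →
          trans (sym (∘ₚ-cong {p = f (fsuc fzero , j)} {t} {f (fsuc fzero , j)} {t} ft≈t ft≈t x))
            (trans (sym (hom (fsuc fzero , j) (fsuc fzero , j) x))
              (rotation-trivial (CycOp j (negMod j)) (CycOp-negMod j) x)))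

lemma2p5 : ∀ {n} (G : FinGroup n) (S : Fin n → Set) →
           InvClosed G S → Connected G S →
           (A : Perm n → Set) → IsSubgroup A →
           (∀ a → A a → ColourPreserving G S a) →
           NormalisedByGR G A →
           (v : Fin n) →
           ((U : Perm n → Set) → IsSubgroup U → U ⊆ Stab A v →
             U ⊆ Squares (Stab A v) →
             ((W : Perm n → Set) → IsSubgroup W → W ⊆ Stab A v → Iso W U →
               (W ⊆ U × U ⊆ W)) →
             ∀ u → U u → u ≈ₚ idP)
           × (∀ k → 2 ≤ k → ¬ IsoTo (Stab A v) (Fin (2 ^ k)) CycOp)
           × (∀ k → 3 ≤ k → ¬ IsoTo (Stab A v) (Fin 2 × Fin (2 ^ k)) DihOp)
lemma2p5 G S S-inv connected A A-sub A-cp A-norm v =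
    (λ U U-sub U⊆stab U⊆squares U-unique →
      unique-square-subgroup-trivial G S-inv A-sub A-cp A-norm v U-sub U⊆stab U⊆squares
        (λ W W-sub W⊆stab iso → proj₁ (U-unique W W-sub W⊆stab iso)) connected)
  , stab≇cyclic G S-inv A-sub A-cp A-norm v connected
  , stab≇dihedral G S-inv A-sub A-cp A-norm v connected
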